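{- Let $h,k$ be integers. If the digraph $G$ is $(h,k)$-out-orderable, then there is a partition of $V(G)$ into $hk$ acyclic sets.
   Context: Digraphs are finite orientations of simple graphs; $\chi(X)$ for $X\subseteq V(G)$ is the chromatic number of the underlying undirected graph of $G[X]$. A digraph $G$ is $(h,k)$-out-orderable if there is a partition $X_1,\ldots,X_n$ of $V(G)$ such that for $1\le i\le n$, $\chi(X_i)\le h$ and each vertex of $X_i$ has at most $k-1$ out-neighbours in $X_{i+1}\cup\cdots\cup X_n$. A set $X\subseteq V(G)$ is acyclic if $G[X]$ has no directed cycle. (Parts of a partition may be empty.) -}

module Defs where

open import Data.Nat using (ℕ; zero; suc; _<_)
open import Data.Fin using (Fin; zero; suc; inject₁; fromℕ) renaming (_<_ to _<ᶠ_)
open import Data.Fin.Properties using (_<?_)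
open import Data.Bool using (Bool; true; false; T)
open import Data.List using (List; length; filter)
open import Data.List.Base using (allFin)
open import Data.Product using (Σ; _×_; ∃)
open import Data.Sum using (_⊎_)
open import Relation.Nullary using (¬_; Dec)
open import Relation.Nullary.Decidable using (_×-dec_)
open import Relation.Binary.PropositionalEquality using (_≡_; _≢_)
open import Function.Definitions using (Injective)
open import Data.Bool.Properties using (T?)

-- A digraph on the vertex set Fin n: an orientation of a finite simple graph.
-- arc u v = true means there is an arc u → v. No loops, and at most one
-- direction between any two vertices.
record Digraph (n : ℕ) : Set where
  field
    arc      : Fin n → Fin n → Bool
    loopless : ∀ v → ¬ T (arc v v)
    oriented : ∀ u v → T (arc u v) → ¬ T (arc v u)
open Digraph public

Adj : ∀ {n} → Digraph n → Fin n → Fin n → Set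
Adj G u v = T (arc G u v) ⊎ T (arc G v u)

VSet : ℕ → Set₁
VSet n = Fin n → Set

ChromLe : ∀ {n} → Digraph n → VSet n → ℕ → Set
ChromLe {n} G X h =
  Σ (Fin n → Fin h) λ c → ∀ u v → X u → X v → Adj G u v → c u ≢ c v

DirCycleIn : ∀ {n} → Digraph n → VSet n → Set
DirCycleIn {n} G X =
  Σ ℕ λ m → Σ (Fin (suc m) → Fin n) λ c →
    Injective _≡_ _≡_ c
    × (∀ i → X (c i))
    × (∀ (j : Fin m) → T (arc G (c (inject₁ j)) (c (suc j))))
    × T (arc G (c (fromℕ m)) (c zero))

Acyclic : ∀ {n} → Digraph n → VSet n → Set
Acyclic G X = ¬ DirCycleIn G X

laterOutDeg : ∀ {n p} → Digraph n → (Fin n → Fin p) → Fin n → ℕ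
laterOutDeg {n} G part v =
  length (filter (λ w → T? (arc G v w) ×-dec (part v <? part w)) (allFin n))

-- (h,k)-out-orderable: an ordered partition X_1,…,X_p (possibly empty parts),
-- given by part : V → Fin p, with χ(X_i) ≤ h and every vertex of X_i having
-- at most k-1 (i.e. fewer than k) out-neighbours in X_{i+1} ∪ … ∪ X_p.
OutOrderable : ∀ {n} → Digraph n → ℕ → ℕ → Set
OutOrderable {n} G h k =
  Σ ℕ λ p → Σ (Fin n → Fin p) λ part →
    (∀ i → ChromLe G (λ v → part v ≡ i) h)
    × (∀ v → laterOutDeg G part v < k)

AcyclicPartition : ∀ {n} → Digraph n → ℕ → Set
AcyclicPartition {n} G q =
  Σ (Fin n → Fin q) λ f → ∀ j → Acyclic G (λ v → f v ≡ j)

-- Properly colour each part Xᵢ with h colours, and colour the vertices a second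
-- time with k colours greedily, from the last part to the first, so that each
-- vertex avoids the second colours of its (fewer than k) out-neighbours in later
-- parts. Inside a class of the product colouring an arc can neither stay in one
-- part (first colour) nor go to a later part (second colour), so every arc goes
-- to a strictly earlier part, and no directed cycle fits in the class.
module Submission where

open import Defs
open import Data.Nat as ℕ using (ℕ; zero; suc; _*_; _∸_; z≤n; s≤s)
import Data.Nat.Properties as ℕ
open import Data.Fin as Fin using (Fin; zero; suc; inject₁; fromℕ; toℕ; combine)
open import Data.Fin.Properties as Fin using (_≟_; _<?_; ¬∀⟶∃¬; <⇒notInjective; combine-injective)
open import Data.List using (List; []; length; map; filter; allFin; lookup)
open import Data.List.Properties using (length-map)
open import Data.List.Membership.Propositional using (_∈_; _∉_)
open import Data.List.Membership.Propositional.Properties using (∈-filter⁺; ∈-filter⁻; ∈-allFin; ∈-map⁺)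
open import Data.List.Relation.Unary.Any using (any?)
open import Data.List.Relation.Unary.Any.Properties using (lookup-index)
open import Data.Product using (Σ; _×_; _,_; proj₁; proj₂; ∃)
open import Data.Sum using (inj₁; inj₂)
open import Data.Bool using (T)
open import Data.Bool.Properties using (T?)
open import Function using (_∘_)
open import Relation.Nullary using (Dec; yes; no; contradiction)
open import Relation.Nullary.Decidable using (_×-dec_)
open import Relation.Binary.PropositionalEquality
open import Relation.Binary.Definitions using (tri<; tri≈; tri>)

length<⇒∃∉ : ∀ {k} (L : List (Fin k)) → length L ℕ.< k → ∃ λ x → x ∉ L
-- Otherwise x ↦ index (x ∈ L) would inject Fin k into Fin (length L).
length<⇒∃∉ {k} L |L|<k = ¬∀⟶∃¬ k (_∈ L) (λ x → any? (x ≟_) L) λ all∈L →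
  <⇒notInjective |L|<k λ {x} {y} ix≡iy →
    trans (lookup-index (all∈L x)) (trans (cong (lookup L) ix≡iy) (sym (lookup-index (all∈L y))))

module GreedyColouring
  {n k : ℕ}
  (N : Fin n → List (Fin n)) (N-small : ∀ v → length (N v) ℕ.< k)
  (rank : Fin n → ℕ) (rank-decreasing : ∀ {v w} → w ∈ N v → rank w ℕ.< rank v)
  where

  Proper : (Fin n → Fin k) → Set
  Proper c = ∀ {v w} → w ∈ N v → c v ≢ c w

  ProperBelow : ℕ → (Fin n → Fin k) → Set
  ProperBelow r c = ∀ {v w} → rank v ℕ.< r → w ∈ N v → c v ≢ c w

  fewColoursAround : ∀ (c : Fin n → Fin k) v → length (map c (N v)) ℕ.< k
  fewColoursAround c v = subst (ℕ._< k) (sym (length-map c (N v))) (N-small v)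

  recolourAt : ℕ → (Fin n → Fin k) → Fin n → Fin k
  recolourAt r c v with rank v ℕ.≟ r
  ... | yes _ = proj₁ (length<⇒∃∉ (map c (N v)) (fewColoursAround c v))
  ... | no  _ = c v

  recolourAt-avoids : ∀ r c {v w} → rank v ≡ r → w ∈ N v → recolourAt r c v ≢ c w
  recolourAt-avoids r c {v} {w} rank≡r w∈N with rank v ℕ.≟ r
  ... | yes _      = λ eq → proj₂ (length<⇒∃∉ _ (fewColoursAround c v))
                                   (subst (_∈ map c (N v)) (sym eq) (∈-map⁺ c w∈N))
  ... | no  rank≢r = contradiction rank≡r rank≢r

  recolourAt-elsewhere : ∀ r c {v} → rank v ≢ r → recolourAt r c v ≡ c v
  recolourAt-elsewhere r c {v} rank≢r with rank v ℕ.≟ r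
  ... | yes rank≡r = contradiction rank≡r rank≢r
  ... | no  _      = refl

  properBelow : ∀ r → Σ (Fin n → Fin k) (ProperBelow r)
  properBelow zero    = (λ v → proj₁ (length<⇒∃∉ [] (ℕ.≤-<-trans z≤n (N-small v)))) , λ ()
  properBelow (suc r) with c , proper ← properBelow r = recolourAt r c , proper′
    where
    proper′ : ProperBelow (suc r) (recolourAt r c)
    -- w has rank below r, so recolouring the vertices of rank r leaves its colour alone.
    proper′ {v} {w} rank<1+r w∈N
      rewrite recolourAt-elsewhere r c (ℕ.<⇒≢ (ℕ.<-≤-trans (rank-decreasing w∈N) (ℕ.≤-pred rank<1+r)))
      with ℕ.m<1+n⇒m<n∨m≡n rank<1+r
    ... | inj₂ rank≡r = recolourAt-avoids r c rank≡r w∈N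
    ... | inj₁ rank<r rewrite recolourAt-elsewhere r c (ℕ.<⇒≢ rank<r) = proper rank<r w∈N

  greedyColouring : ∀ {r} → (∀ v → rank v ℕ.< r) → Σ (Fin n → Fin k) Proper
  greedyColouring {r} rank<r with c , proper ← properBelow r = c , proper (rank<r _)

descending⇒last≤head : ∀ m (f : Fin (suc m) → ℕ) →
  (∀ (j : Fin m) → f (suc j) ℕ.≤ f (inject₁ j)) → f (fromℕ m) ℕ.≤ f zero
descending⇒last≤head zero    f desc = ℕ.≤-refl
descending⇒last≤head (suc m) f desc =
  ℕ.≤-trans (desc (fromℕ m)) (descending⇒last≤head m (f ∘ inject₁) (desc ∘ inject₁))

acyclic-if-potential-decreasing : ∀ {n} (G : Digraph n) (X : VSet n) (φ : Fin n → ℕ) →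
  (∀ {u w} → X u → X w → T (arc G u w) → φ w ℕ.< φ u) → Acyclic G X
acyclic-if-potential-decreasing G X φ decreasing (m , c , _ , c∈X , path , closing) =
  ℕ.<-irrefl refl (ℕ.<-≤-trans (decreasing (c∈X _) (c∈X _) closing)
    (descending⇒last≤head m (λ i → φ (c i)) λ j → ℕ.<⇒≤ (decreasing (c∈X _) (c∈X _) (path j))))

module OrderedPartition {n p : ℕ} (G : Digraph n) (part : Fin n → Fin p) where

  later? : ∀ v w → Dec (T (arc G v w) × part v Fin.< part w)
  later? v w = T? (arc G v w) ×-dec (part v <? part w)

  later : Fin n → List (Fin n)
  later v = filter (later? v) (allFin n)

  rank : Fin n → ℕ
  rank v = p ∸ toℕ (part v)

  rank≤p : ∀ v → rank v ℕ.≤ p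
  rank≤p v = ℕ.m∸n≤m p (toℕ (part v))

  rank-decreasing : ∀ {v w} → w ∈ later v → rank w ℕ.< rank v
  rank-decreasing w∈later =
    ℕ.∸-monoʳ-< (proj₂ (proj₂ (∈-filter⁻ (later? _) {xs = allFin n} w∈later))) (ℕ.<⇒≤ (Fin.toℕ<n _))

  ProperOnParts : ∀ {h} → (Fin n → Fin h) → Set
  ProperOnParts a = ∀ {u w} → part u ≡ part w → T (arc G u w) → a u ≢ a w

  ProperOnLater : ∀ {k} → (Fin n → Fin k) → Set
  ProperOnLater b = ∀ {u w} → w ∈ later u → b u ≢ b w

  partwiseColouring : ∀ {h} → (∀ i → ChromLe G (λ v → part v ≡ i) h) → Σ (Fin n → Fin h) ProperOnParts
  partwiseColouring χ≤h = (λ v → proj₁ (χ≤h (part v)) v) , λ {u} {w} u~w u→w au≡aw →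
    proj₂ (χ≤h (part u)) u w refl (sym u~w) (inj₁ u→w)
      (trans au≡aw (cong (λ i → proj₁ (χ≤h i) w) (sym u~w)))

  module _ {h k} (a : Fin n → Fin h) (b : Fin n → Fin k) where

    sameCombine⇒earlier : ProperOnParts a → ProperOnLater b →
      ∀ {u w} → combine (a u) (b u) ≡ combine (a w) (b w) → T (arc G u w) → toℕ (part w) ℕ.< toℕ (part u)
    sameCombine⇒earlier a-proper b-proper {u} {w} same u→w
      with au≡aw , bu≡bw ← combine-injective _ _ _ _ same | Fin.<-cmp (part u) (part w)
    ... | tri< u<w _ _ = contradiction bu≡bw (b-proper (∈-filter⁺ (later? u) (∈-allFin w) (u→w , u<w)))
    ... | tri≈ _ u~w _ = contradiction au≡aw (a-proper u~w u→w)
    ... | tri> _ _ w<u = w<u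

    combineClass-acyclic : ProperOnParts a → ProperOnLater b →
      ∀ j → Acyclic G (λ v → combine (a v) (b v) ≡ j)
    combineClass-acyclic a-proper b-proper j = acyclic-if-potential-decreasing G _ (toℕ ∘ part)
      λ u∈j w∈j → sameCombine⇒earlier a-proper b-proper (trans u∈j (sym w∈j))

mainTheorem6 : (h k n : ℕ) (G : Digraph n) →
    OutOrderable G h k → AcyclicPartition G (h * k)
mainTheorem6 h k n G (p , part , χ≤h , outDeg<k) =
  (λ v → combine (a v) (b v)) , combineClass-acyclic a b a-proper b-proper
  where
  open OrderedPartition G part
  open GreedyColouring later outDeg<k rank rank-decreasing

  a : Fin n → Fin h
  a = proj₁ (partwiseColouring χ≤h)

  a-proper : ProperOnParts a
  a-proper = proj₂ (partwiseColouring χ≤h)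

  b : Fin n → Fin k
  b = proj₁ (greedyColouring (s≤s ∘ rank≤p))

  b-proper : ProperOnLater b
  b-proper = proj₂ (greedyColouring (s≤s ∘ rank≤p))
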